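{- Let $p\ge 11$ be a prime, write $\eta(p\tau)^p/\eta(\tau)=\sum_{n\ge1}c(n)q^n$ with $q=e^{2\pi i\tau}$, and let $L_{\Phi_p}(s)=\sum_{n\ge1}c(n)n^{ -s}$. Then there do not exist constants $a,b\in\mathbb C$ and Dirichlet series $M(s),N(s)$ admitting Euler products such that $L_{\Phi_p}(s)=aM(s)+bN(s)$.
   Context: $\eta(\tau)=q^{1/24}\prod_{n\ge1}(1-q^n)$, so $\eta(p\tau)^p/\eta(\tau)=q^{(p^2-1)/24}\prod_{n\ge1}(1-q^{pn})^p/(1-q^n)$. A Dirichlet series $\sum a(n)n^{ -s}$ admits an Euler product if $a(1)=1$ and $a(mn)=a(m)a(n)$ whenever $\gcd(m,n)=1$. -}

module Defs where

open import Level using (Level; _⊔_)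
open import Data.Nat as ℕ using (ℕ; zero; suc; _∸_; _≡ᵇ_)
open import Data.Nat.Divisibility using (_∣?_)
open import Data.Nat.Coprimality using (Coprime)
open import Data.Integer as ℤ using (ℤ; +_; -[1+_])
open import Data.Bool using (if_then_else_)
open import Data.Product using (∃)
open import Relation.Nullary using (¬_; does)
open import Relation.Binary.PropositionalEquality using (_≡_)
open import Algebra.Bundles using (CommutativeRing)

Series : Set
Series = ℕ → ℤ

sumTo : ℕ → (ℕ → ℤ) → ℤ
sumTo zero    h = h zero
sumTo (suc n) h = sumTo n h ℤ.+ h (suc n)

_⊛_ : Series → Series → Series
(f ⊛ g) n = sumTo n (λ k → f k ℤ.* g (n ∸ k))

oneS : Series
oneS zero    = + 1
oneS (suc _) = + 0

powS : Series → ℕ → Series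
powS f zero    = oneS
powS f (suc k) = f ⊛ powS f k

-- the polynomial 1 - q^m   (used for m ≥ 1)
oneMinusQ : ℕ → Series
oneMinusQ m zero    = + 1
oneMinusQ m (suc n) = if (suc n ≡ᵇ m) then ℤ.- (+ 1) else + 0

-- the series 1/(1 - q^m) = Σ_k q^{mk}   (used for m ≥ 1)
geomInv : ℕ → Series
geomInv m n = if does (m ∣? n) then + 1 else + 0

-- factor for index m ≥ 1 of  ∏_{m≥1} (1 - q^{pm})^p / (1 - q^m)
etaFactor : ℕ → ℕ → Series
etaFactor p m = powS (oneMinusQ (p ℕ.* m)) p ⊛ geomInv m

-- ∏_{m=1}^{N} etaFactor p m ; agrees with the infinite product in degrees ≤ N
etaProd : ℕ → ℕ → Series
etaProd p zero    = oneS
etaProd p (suc N) = etaProd p N ⊛ etaFactor p (suc N)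

etaShift : ℕ → ℕ
etaShift p = (p ℕ.* p ∸ 1) ℕ./ 24

-- c p n : the coefficient of q^n in  η(pτ)^p / η(τ)
--       = q^{(p²-1)/24} ∏_{m≥1} (1-q^{pm})^p / (1-q^m).
c : ℕ → ℕ → ℤ
c p n = if does (etaShift p ℕ.≤? n)
          then etaProd p n (n ∸ etaShift p)
          else + 0

-- Fields of characteristic zero (stdlib has no Field bundle).

module _ {a ℓ : Level} (R : CommutativeRing a ℓ) where
  open CommutativeRing R

  fromℕ : ℕ → Carrier
  fromℕ zero    = 0#
  fromℕ (suc n) = 1# + fromℕ n

  fromℤ : ℤ → Carrier
  fromℤ (+ n)      = fromℕ n
  fromℤ -[1+ n ]   = - fromℕ (suc n)

  record IsCharZeroField : Set (a ⊔ ℓ) where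
    field
      nontrivial : ¬ (0# ≈ 1#)
      inverse    : ∀ x → ¬ (x ≈ 0#) → ∃ λ y → x * y ≈ 1#
      charZero   : ∀ n → fromℕ n ≈ 0# → n ≡ 0

  -- The Dirichlet series Σ f(n) n^{-s} admits an Euler product:
  -- f(1) = 1 and f(mn) = f(m) f(n) for coprime m, n ≥ 1.
  record HasEulerProduct (f : ℕ → Carrier) : Set (a ⊔ ℓ) where
    field
      one  : f 1 ≈ 1#
      mult : ∀ m n → 1 ℕ.≤ m → 1 ℕ.≤ n → Coprime m n → f (m ℕ.* n) ≈ f m * f n

-- Put f n = α M(n) + β N(n) and s = (p² − 1)/24 ≥ 5. The coefficients c(n) vanish for
-- 0 < n < s, so M(1) = N(1) = 1 forces α + β = 0, and f vanishes at 2 and at every odd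
-- k < s. With α + β = 0, multiplicativity gives f(2k) = 0 as well. But some 2k with k odd
-- lies in [s, s + 3], and c(s + j) is the partition number p(j) > 0 for j ≤ 3, which is
-- nonzero in characteristic zero.
module Submission where

open import Defs
open import Level using (Level)
open import Data.Nat using (ℕ; _≤_)
open import Data.Nat.Primality using (Prime)
open import Data.Product using (Σ; _×_)
open import Relation.Nullary using (¬_)
open import Algebra.Bundles using (CommutativeRing)

open import Data.Nat as ℕ using (zero; suc; s≤s; z≤n; z<s; _<_; _≤?_)
open import Data.Nat.Properties
  using (≤-trans; m≤m*n; m≤m+n; <⇒≱; m+n∸m≡n; m+[n∸m]≡n; ∸-monoˡ-≤; *-mono-≤; *-distribˡ-+;
         +-monoʳ-<; *-cancelˡ-<; 1+n≢0; module ≤-Reasoning)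
open import Data.Nat.DivMod using (/-monoˡ-≤)
open import Data.Nat.Coprimality using (Coprime; 1-coprimeTo; coprime-+)
import Data.Nat.Coprimality as Coprime
open import Data.Integer using (ℤ; +_)
open import Data.Product using (_,_; ∃₂)
open import Relation.Nullary.Decidable using (dec-true; dec-false)
open import Relation.Binary.PropositionalEquality
  using (_≡_; refl; cong; cong₂; module ≡-Reasoning)
import Relation.Binary.PropositionalEquality as ≡
import Algebra.Solver.Ring.NaturalCoefficients.Default as NaturalCoefficientsSolver
import Relation.Binary.Reasoning.Setoid as SetoidReasoning

module _ {a ℓ : Level} (K : CommutativeRing a ℓ) where
  open CommutativeRing K renaming (refl to ≈-refl)
  open SetoidReasoning setoid

  combination-of-products≈0 : ∀ α β x y x′ y′ → α + β ≈ 0# →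
    α * x + β * y ≈ 0# → α * x′ + β * y′ ≈ 0# → α * (x * x′) + β * (y * y′) ≈ 0#
  combination-of-products≈0 α β x y x′ y′ α+β≈0 αx+βy≈0 αx′+βy′≈0 = begin
    α * (x * x′) + β * (y * y′)                     ≈⟨ +-identityʳ _ ⟨
    α * (x * x′) + β * (y * y′) + 0#                ≈⟨ +-congˡ (trans (*-congˡ α+β≈0) (zeroʳ _)) ⟨
    α * (x * x′) + β * (y * y′) + y * x′ * (α + β)  ≈⟨ cross-identity ⟩
    x′ * (α * x + β * y) + y * (α * x′ + β * y′)    ≈⟨ +-cong (*-congˡ αx+βy≈0) (*-congˡ αx′+βy′≈0) ⟩
    x′ * 0# + y * 0#                                ≈⟨ +-cong (zeroʳ x′) (zeroʳ y) ⟩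
    0# + 0#                                         ≈⟨ +-identityʳ 0# ⟩
    0#                                              ∎
    where
    open NaturalCoefficientsSolver commutativeSemiring
    cross-identity : α * (x * x′) + β * (y * y′) + y * x′ * (α + β)
                   ≈ x′ * (α * x + β * y) + y * (α * x′ + β * y′)
    cross-identity = solve 6
      (λ α β x y x′ y′ → α :* (x :* x′) :+ β :* (y :* y′) :+ y :* x′ :* (α :+ β)
                      := x′ :* (α :* x :+ β :* y) :+ y :* (α :* x′ :+ β :* y′))
      ≈-refl α β x y x′ y′

  combination-of-multiplicative≈0 : ∀ {M N : ℕ → Carrier} →
    HasEulerProduct K M → HasEulerProduct K N → ∀ α β {m n} → 1 ≤ m → 1 ≤ n → Coprime m n →
    α * M 1 + β * N 1 ≈ 0# → α * M m + β * N m ≈ 0# → α * M n + β * N n ≈ 0# →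
    α * M (m ℕ.* n) + β * N (m ℕ.* n) ≈ 0#
  combination-of-multiplicative≈0 {M} {N} M-euler N-euler α β {m} {n} 1≤m 1≤n m⊥n f1≈0 fm≈0 fn≈0 =
    begin
      α * M (m ℕ.* n) + β * N (m ℕ.* n)
        ≈⟨ +-cong (*-congˡ (mult M-euler m n 1≤m 1≤n m⊥n))
                  (*-congˡ (mult N-euler m n 1≤m 1≤n m⊥n)) ⟩
      α * (M m * M n) + β * (N m * N n)
        ≈⟨ combination-of-products≈0 α β (M m) (N m) (M n) (N n) α+β≈0 fm≈0 fn≈0 ⟩
      0# ∎
    where
    open HasEulerProduct
    α+β≈0 : α + β ≈ 0#
    α+β≈0 = begin
      α + β             ≈⟨ +-cong (*-identityʳ α) (*-identityʳ β) ⟨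
      α * 1# + β * 1#   ≈⟨ +-cong (*-congˡ (one M-euler)) (*-congˡ (one N-euler)) ⟨
      α * M 1 + β * N 1 ≈⟨ f1≈0 ⟩
      0#                ∎

Truncated₄ : Set
Truncated₄ = ℤ × ℤ × ℤ × ℤ

truncate₄ : Series → Truncated₄
truncate₄ f = f 0 , f 1 , f 2 , f 3

extend : Truncated₄ → Series
extend (f₀ , _  , _  , _ ) 0 = f₀
extend (_  , f₁ , _  , _ ) 1 = f₁
extend (_  , _  , f₂ , _ ) 2 = f₂
extend (_  , _  , _  , f₃) 3 = f₃
extend _ _ = + 0

extend-truncate₄ : ∀ f {j} → j ≤ 3 → extend (truncate₄ f) j ≡ f j
extend-truncate₄ f {0} _ = refl
extend-truncate₄ f {1} _ = refl
extend-truncate₄ f {2} _ = refl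
extend-truncate₄ f {3} _ = refl
extend-truncate₄ f {suc (suc (suc (suc _)))} (s≤s (s≤s (s≤s ())))

-- truncate₄ (f ⊛ g) ≡ truncate₄ f ⊛₄ truncate₄ g holds by computation, because the coefficient
-- of q^n in f ⊛ g reads f and g only in degrees ≤ n.
_⊛₄_ : Truncated₄ → Truncated₄ → Truncated₄
f ⊛₄ g = truncate₄ (extend f ⊛ extend g)

one₄ : Truncated₄
one₄ = truncate₄ oneS

truncate₄-powS-one : ∀ {f} → truncate₄ f ≡ one₄ → ∀ k → truncate₄ (powS f k) ≡ one₄
truncate₄-powS-one f≡1 zero    = refl
truncate₄-powS-one f≡1 (suc k) = cong₂ _⊛₄_ f≡1 (truncate₄-powS-one f≡1 k)

truncate₄-oneMinusQ : ∀ {m} → 4 ≤ m → truncate₄ (oneMinusQ m) ≡ one₄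
truncate₄-oneMinusQ (s≤s (s≤s (s≤s (s≤s _)))) = refl

truncate₄-geomInv : ∀ {m} → 4 ≤ m → truncate₄ (geomInv m) ≡ one₄
truncate₄-geomInv (s≤s (s≤s (s≤s (s≤s _)))) = refl

truncate₄-etaFactor : ∀ {p} → 4 ≤ p → ∀ m →
  truncate₄ (etaFactor p (suc m)) ≡ one₄ ⊛₄ truncate₄ (geomInv (suc m))
truncate₄-etaFactor {p} 4≤p m =
  cong (_⊛₄ truncate₄ (geomInv (suc m))) (truncate₄-powS-one 1-q^pm≡1 p)
  where
  1-q^pm≡1 : truncate₄ (oneMinusQ (p ℕ.* suc m)) ≡ one₄
  1-q^pm≡1 = truncate₄-oneMinusQ (≤-trans 4≤p (m≤m*n p (suc m)))

-- p(0), …, p(3): modulo q⁴ the product is ∏_{m ≤ 3} 1/(1 − q^m), the partition generating function.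
partitions₄ : Truncated₄
partitions₄ = + 1 , + 1 , + 2 , + 3

truncate₄-etaProd : ∀ {p} → 4 ≤ p → ∀ N → truncate₄ (etaProd p (3 ℕ.+ N)) ≡ partitions₄
truncate₄-etaProd 4≤p zero =
  cong₂ _⊛₄_ (cong₂ _⊛₄_ (cong (one₄ ⊛₄_) (truncate₄-etaFactor 4≤p 0)) (truncate₄-etaFactor 4≤p 1))
             (truncate₄-etaFactor 4≤p 2)
truncate₄-etaProd 4≤p (suc N) =
  cong₂ _⊛₄_ (truncate₄-etaProd 4≤p N) (≡.trans (truncate₄-etaFactor 4≤p (3 ℕ.+ N)) 1/[1-q^m]≡1)
  where
  1/[1-q^m]≡1 : one₄ ⊛₄ truncate₄ (geomInv (4 ℕ.+ N)) ≡ one₄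
  1/[1-q^m]≡1 = cong (one₄ ⊛₄_) (truncate₄-geomInv (m≤m+n 4 N))

partitions₄-positive : ∀ {j} → j ≤ 3 → Σ ℕ λ v → extend partitions₄ j ≡ + suc v
partitions₄-positive {0} _ = 0 , refl
partitions₄-positive {1} _ = 0 , refl
partitions₄-positive {2} _ = 1 , refl
partitions₄-positive {3} _ = 2 , refl
partitions₄-positive {suc (suc (suc (suc _)))} (s≤s (s≤s (s≤s ())))

etaShift-mono : ∀ {p q} → p ≤ q → etaShift p ≤ etaShift q
etaShift-mono p≤q = /-monoˡ-≤ 24 (∸-monoˡ-≤ 1 (*-mono-≤ p≤q p≤q))

c-below-shift : ∀ p {n} → n < etaShift p → c p n ≡ + 0
c-below-shift p {n} n<s rewrite dec-false (etaShift p ≤? n) (<⇒≱ n<s) = refl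

c-above-shift : ∀ p j → c p (etaShift p ℕ.+ j) ≡ etaProd p (etaShift p ℕ.+ j) j
c-above-shift p j rewrite dec-true (etaShift p ≤? etaShift p ℕ.+ j) (m≤m+n (etaShift p) j)
                        | m+n∸m≡n (etaShift p) j = refl

c-shift≡partitions₄ : ∀ {p j} → 4 ≤ p → 3 ≤ etaShift p → j ≤ 3 →
  c p (etaShift p ℕ.+ j) ≡ extend partitions₄ j
c-shift≡partitions₄ {p} {j} 4≤p 3≤s j≤3 = begin
  c p (s ℕ.+ j)                              ≡⟨ c-above-shift p j ⟩
  etaProd p (s ℕ.+ j) j                      ≡⟨ cong (λ n → etaProd p n j) (m+[n∸m]≡n 3≤s+j) ⟨
  etaProd p (3 ℕ.+ t) j                      ≡⟨ extend-truncate₄ (etaProd p (3 ℕ.+ t)) j≤3 ⟨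
  extend (truncate₄ (etaProd p (3 ℕ.+ t))) j ≡⟨ cong (λ f → extend f j) (truncate₄-etaProd 4≤p t) ⟩
  extend partitions₄ j                       ∎
  where
  open ≡-Reasoning
  s t : ℕ
  s = etaShift p
  t = s ℕ.+ j ℕ.∸ 3
  3≤s+j : 3 ≤ s ℕ.+ j
  3≤s+j = ≤-trans 3≤s (m≤m+n s j)

c-shift-positive : ∀ {p j} → 11 ≤ p → j ≤ 3 → Σ ℕ λ v → c p (etaShift p ℕ.+ j) ≡ + suc v
c-shift-positive {p} 11≤p j≤3 with partitions₄-positive j≤3
... | v , p[j]≡1+v = v , ≡.trans (c-shift≡partitions₄ 4≤p 3≤s j≤3) p[j]≡1+v
  where
  4≤p : 4 ≤ p
  4≤p = ≤-trans (m≤m+n 4 7) 11≤p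
  3≤s : 3 ≤ etaShift p
  3≤s = etaShift-mono {9} (≤-trans (m≤m+n 9 2) 11≤p)

twice-odd-above : ∀ s → ∃₂ λ j q → j ≤ 3 × s ℕ.+ j ≡ 2 ℕ.* suc (q ℕ.* 2)
twice-odd-above 0 = 2 , 0 , s≤s (s≤s z≤n) , refl
twice-odd-above 1 = 1 , 0 , s≤s z≤n , refl
twice-odd-above 2 = 0 , 0 , z≤n , refl
twice-odd-above 3 = 3 , 1 , s≤s (s≤s (s≤s z≤n)) , refl
twice-odd-above (suc (suc (suc (suc s)))) with twice-odd-above s
... | j , q , j≤3 , s+j≡2k =
  j , suc q , j≤3 , ≡.trans (cong (4 ℕ.+_) s+j≡2k) (≡.sym (*-distribˡ-+ 2 2 (suc (q ℕ.* 2))))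

2-coprime-odd : ∀ q → Coprime 2 (suc (q ℕ.* 2))
2-coprime-odd q = Coprime.sym (odd-coprime-2 q)
  where
  odd-coprime-2 : ∀ q → Coprime (suc (q ℕ.* 2)) 2
  odd-coprime-2 zero    = 1-coprimeTo 2
  odd-coprime-2 (suc q) = coprime-+ (odd-coprime-2 q)

half-below : ∀ {s j k} → 4 ≤ s → j ≤ 3 → s ℕ.+ j ≡ 2 ℕ.* k → k < s
half-below {s} {j} {k} 4≤s j≤3 s+j≡2k = *-cancelˡ-< 2 k s (begin-strict
  2 ℕ.* k   ≡⟨ s+j≡2k ⟨
  s ℕ.+ j   <⟨ +-monoʳ-< s (≤-trans (s≤s j≤3) (≤-trans 4≤s (m≤m+n s 0))) ⟩
  2 ℕ.* s   ∎)
  where open ≤-Reasoning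

mainTheorem5 : ∀ {a ℓ : Level} (p : ℕ) → Prime p → 11 ≤ p →
    (K : CommutativeRing a ℓ) → IsCharZeroField K →
    ¬ (Σ (CommutativeRing.Carrier K) λ α → Σ (CommutativeRing.Carrier K) λ β →
       Σ (ℕ → CommutativeRing.Carrier K) λ M → Σ (ℕ → CommutativeRing.Carrier K) λ N →
       HasEulerProduct K M × HasEulerProduct K N ×
       (∀ n → 1 ≤ n → CommutativeRing._≈_ K (fromℤ K (c p n))
          (CommutativeRing._+_ K (CommutativeRing._*_ K α (M n)) (CommutativeRing._*_ K β (N n)))))
mainTheorem5 p _ 11≤p K F (α , β , M , N , M-euler , N-euler , c≈f)
  with twice-odd-above (etaShift p)
... | j , q , j≤3 , s+j≡2k with c-shift-positive 11≤p j≤3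
... | v , c[s+j]≡1+v = 1+n≢0 (charZero (suc v) 1+v≈0)
  where
  open CommutativeRing K
  open IsCharZeroField F
  open SetoidReasoning setoid
  s k : ℕ
  s = etaShift p
  k = suc (q ℕ.* 2)
  5≤s : 5 ≤ s
  5≤s = etaShift-mono 11≤p
  combination≈0-below : ∀ {n} → 1 ≤ n → n < s → α * M n + β * N n ≈ 0#
  combination≈0-below {n} 1≤n n<s =
    trans (sym (c≈f n 1≤n)) (reflexive (cong (fromℤ K) (c-below-shift p n<s)))
  1+v≈0 : fromℕ K (suc v) ≈ 0#
  1+v≈0 = begin
    fromℤ K (+ suc v)                  ≡⟨ cong (fromℤ K) c[s+j]≡1+v ⟨
    fromℤ K (c p (s ℕ.+ j))            ≈⟨ c≈f (s ℕ.+ j) (≤-trans z<s (≤-trans 5≤s (m≤m+n s j))) ⟩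
    α * M (s ℕ.+ j) + β * N (s ℕ.+ j)  ≡⟨ cong (λ n → α * M n + β * N n) s+j≡2k ⟩
    α * M (2 ℕ.* k) + β * N (2 ℕ.* k)  ≈⟨ combination-of-multiplicative≈0 K M-euler N-euler α β
                                             z<s z<s (2-coprime-odd q)
                                             (combination≈0-below z<s 1<s)
                                             (combination≈0-below z<s 2<s)
                                             (combination≈0-below z<s k<s) ⟩
    0#                                 ∎
    where
    1<s : 1 < s
    1<s = ≤-trans (m≤m+n 2 3) 5≤s
    2<s : 2 < s
    2<s = ≤-trans (m≤m+n 3 2) 5≤s
    k<s : k < s
    k<s = half-below (≤-trans (m≤m+n 4 1) 5≤s) j≤3 s+j≡2k
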